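{- Let $m$ be a positive integer and $p$ a prime with $p>m$; let $q=\lfloor p/m\rfloor$. Define $f_{m,p,i}$ ($0\le i\le\varphi(m)-1$) and $f_{m,p,i,j}$ ($0\le j\le q$) by $$\Phi_{mp}=\sum_{i=0}^{\varphi(m)-1}f_{m,p,i}\,x^{ip},\ \deg f_{m,p,i}<p,\qquad f_{m,p,i}=\sum_{j=0}^{q}f_{m,p,i,j}\,x^{jm},\ \deg f_{m,p,i,j}<m.$$ For $0\le i\le\varphi(m)-1$ let $g^{\mathsf b}_{m,i}=m+\operatorname{tdeg}f_{m,p,i,1}-\deg f_{m,p,i,0}$ if $q\ge 2$ (the gap in $\Phi_{mp}$ between the blocks $f_{m,p,i,0}$ and $f_{m,p,i,1}$), and $g^{\mathsf b}_{m,i}=0$ if $q=1$. Then $g^{\mathsf b}_{m,i}\le\varphi(m)$ for every $0\le i\le\varphi(m)-1$.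
   Context: $\Phi_n$ is the $n$-th cyclotomic polynomial and $\varphi$ is Euler's totient function. For a nonzero polynomial $f$, $\operatorname{tdeg}f$ is the smallest exponent whose coefficient in $f$ is nonzero. -}

module Defs where

open import Data.Nat using (ℕ; zero; suc; _+_; _*_; _∸_; _≤_; _<_; _<ᵇ_)
open import Data.Nat.Divisibility using (_∣?_)
open import Data.Nat.GCD using (gcd)
open import Data.Nat.Properties using (_≟_)
open import Data.Integer using (ℤ; 0ℤ; 1ℤ; -1ℤ) renaming (_+_ to _+ℤ_; _*_ to _*ℤ_)
open import Data.List using (List; []; _∷_; map; foldr; filter; length; upTo; replicate; _++_)
open import Data.Bool using (if_then_else_; _∧_)
open import Data.Product using (_×_)
open import Relation.Binary.PropositionalEquality using (_≡_; _≢_)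

φ : ℕ → ℕ
φ n = length (filter (λ k → gcd k n ≟ 1) (map suc (upTo n)))

-- Polynomials over ℤ as coefficient lists, lowest degree first.
Poly : Set
Poly = List ℤ

coeff : Poly → ℕ → ℤ
coeff []      _       = 0ℤ
coeff (a ∷ f) zero    = a
coeff (a ∷ f) (suc k) = coeff f k

_+P_ : Poly → Poly → Poly
[]      +P g       = g
(a ∷ f) +P []      = a ∷ f
(a ∷ f) +P (b ∷ g) = (a +ℤ b) ∷ (f +P g)

scaleP : ℤ → Poly → Poly
scaleP c = map (c *ℤ_)

_*P_ : Poly → Poly → Poly
[]      *P g = []
(a ∷ f) *P g = scaleP a g +P (0ℤ ∷ (f *P g))

prodP : List Poly → Poly
prodP = foldr _*P_ (1ℤ ∷ [])

xpow : ℕ → Poly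
xpow n = replicate n 0ℤ ++ (1ℤ ∷ [])

xpow-1 : ℕ → Poly
xpow-1 n = xpow n +P (-1ℤ ∷ [])

divisors : ℕ → List ℕ
divisors n = filter (λ d → d ∣? n) (map suc (upTo n))

-- Φ is the family of cyclotomic polynomials: for every n ≥ 1,
-- ∏_{d ∣ n} Φ d = x^n - 1 (coefficientwise). This determines Φ n uniquely for n ≥ 1.
IsCyclotomic : (ℕ → Poly) → Set
IsCyclotomic Φ = ∀ n → 1 ≤ n → ∀ k → coeff (prodP (map Φ (divisors n))) k ≡ coeff (xpow-1 n) k

-- Coefficient function of the block f_{m,p,i,j} of Φ_{mp}:
-- f_{m,p,i} has coefficients Φ_{mp}[i p + k] for k < p,
-- f_{m,p,i,j} has coefficients f_{m,p,i}[j m + l] for l < m.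
block : (ℕ → Poly) → ℕ → ℕ → ℕ → ℕ → ℕ → ℤ
block Φ m p i j l =
  if (l <ᵇ m) ∧ ((j * m + l) <ᵇ p)
  then coeff (Φ (m * p)) (i * p + (j * m + l))
  else 0ℤ

IsDeg : (ℕ → ℤ) → ℕ → Set
IsDeg f d = f d ≢ 0ℤ × (∀ k → d < k → f k ≡ 0ℤ)

IsTdeg : (ℕ → ℤ) → ℕ → Set
IsTdeg f t = f t ≢ 0ℤ × (∀ k → k < t → f k ≡ 0ℤ)

{-# OPTIONS --safe #-}
-- Since p ∤ m, Φ_m(x) Φ_{mp}(x) = Φ_m(x^p); we only use that Φ_m Φ_{mp} is p-sparse, which follows by
-- strong induction on m from x^{mp} - 1 = ∏_{e ∣ m} Φ_e Φ_{ep}.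
-- Let N = i p + m + t be the exponent of the first nonzero coefficient of f_{m,p,i,1}; since
-- 0 < m + t < p, the coefficient of x^N in Φ_m Φ_{mp} is 0. If the gap exceeded φ(m) = deg Φ_m
-- (a consequence of Gauss's identity ∑_{d ∣ n} φ(d) = n), the coefficients of Φ_{mp} at N - 1, …, N - φ(m)
-- would all lie in the gap, leaving Φ_m(0) · [x^N] Φ_{mp} ≠ 0 as that coefficient.
module Submission where

open import Algebra.Bundles using (CommutativeMonoid)
open import Data.Bool using (true; false; if_then_else_; T)
open import Data.Bool.Properties using (T-≡)
open import Data.Empty using (⊥-elim)
open import Data.Fin using (toℕ)
open import Data.Integer using (ℤ; 0ℤ; 1ℤ; -1ℤ) renaming (_+_ to _+ℤ_; _*_ to _*ℤ_)
import Data.Integer.Properties as ℤ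
open import Data.Integer.Solver using (module +-*-Solver)
open import Data.List using (List; []; _∷_; map; foldr; filter; length; upTo; applyUpTo)
open import Data.List.Properties using (map-applyUpTo)
open import Data.Nat as ℕ using (ℕ; zero; suc; _+_; _*_; _≤_; _<_; _∸_; s≤s; z≤n; NonZero; _/_; _≟_)
import Data.Nat.Properties as ℕ
open import Data.Nat.Coprimality using (Coprime; coprime-divisor)
open import Data.Nat.Divisibility
  using ( _∣_; _∣?_; divides; _∣0; ∣m+n∣m⇒∣n; ∣m∸n∣n⇒∣m; ∣-refl; ∣-trans; ∣⇒≤; m∣m*n; n∣m*n
        ; *-cancelʳ-∣; *-monoˡ-∣)
open import Data.Nat.GCD using (gcd; gcd[m,n]∣m; gcd[m,n]∣n; gcd[m,n]≢0; c*gcd[m,n]≡gcd[cm,cn])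
open import Data.Nat.Induction using (<-rec)
open import Data.Nat.Primality using (Prime; prime⇒irreducible)
open import Data.Product using (_×_; _,_; proj₁; proj₂; Σ-syntax)
open import Data.Sum using (_⊎_; inj₁; inj₂; [_,_]′)
open import Function using (_∘_; id)
open import Function.Bundles using (_⇔_; mk⇔; Equivalence)
open import Level using (0ℓ)
open import Relation.Binary using (Setoid; tri<; tri≈; tri>)
open import Relation.Binary.PropositionalEquality
  using (_≡_; _≢_; refl; sym; trans; cong; cong₂; subst; cong-app; _≗_; _→-setoid_; module ≡-Reasoning)
open import Relation.Nullary using (¬_; Dec; yes; no; does)
open import Relation.Nullary.Decidable using (dec-true; dec-false; does-⇔)
open import Relation.Unary using (Pred; Decidable)

open import Defs

open +-*-Solver

Series : Set
Series = ℕ → ℤ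

-- Cauchy product: (F ⋆ G) k = ∑_{i ≤ k} F i · G (k ∸ i).
infixl 7 _⋆_
_⋆_ : Series → Series → Series
(F ⋆ G) zero    = F 0 *ℤ G 0
(F ⋆ G) (suc k) = F 0 *ℤ G (suc k) +ℤ ((F ∘ suc) ⋆ G) k

one : Series
one zero    = 1ℤ
one (suc _) = 0ℤ

⋆-congˡ : ∀ {F F′} G → F ≗ F′ → F ⋆ G ≗ F′ ⋆ G
⋆-congˡ G F≗F′ zero    = cong (_*ℤ G 0) (F≗F′ 0)
⋆-congˡ G F≗F′ (suc k) = cong₂ (λ a b → a *ℤ G (suc k) +ℤ b) (F≗F′ 0) (⋆-congˡ G (F≗F′ ∘ suc) k)

⋆-congʳ : ∀ F {G G′} → G ≗ G′ → F ⋆ G ≗ F ⋆ G′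
⋆-congʳ F G≗G′ zero    = cong (F 0 *ℤ_) (G≗G′ 0)
⋆-congʳ F G≗G′ (suc k) = cong₂ (λ a b → F 0 *ℤ a +ℤ b) (G≗G′ (suc k)) (⋆-congʳ (F ∘ suc) G≗G′ k)

⋆-vanishes : ∀ F G k → (∀ i → i ≤ k → F i *ℤ G (k ∸ i) ≡ 0ℤ) → (F ⋆ G) k ≡ 0ℤ
⋆-vanishes F G zero    terms = terms 0 z≤n
⋆-vanishes F G (suc k) terms =
  cong₂ _+ℤ_ (terms 0 z≤n) (⋆-vanishes (F ∘ suc) G k (λ i i≤k → terms (suc i) (s≤s i≤k)))

⋆-zeroˡ : ∀ {F} G → (∀ j → F j ≡ 0ℤ) → ∀ k → (F ⋆ G) k ≡ 0ℤ
⋆-zeroˡ {F} G F≡0 k = ⋆-vanishes F G k (λ i _ → cong (_*ℤ G (k ∸ i)) (F≡0 i))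

⋆-sucʳ : ∀ F G k → (F ⋆ G) (suc k) ≡ G 0 *ℤ F (suc k) +ℤ (F ⋆ (G ∘ suc)) k
⋆-sucʳ F G zero = solve 4 (λ a b c d → a :* b :+ c :* d := d :* c :+ a :* b) refl (F 0) (G 1) (F 1) (G 0)
⋆-sucʳ F G (suc k) rewrite ⋆-sucʳ (F ∘ suc) G k =
  solve 3 (λ a b c → a :+ (b :+ c) := b :+ (a :+ c)) refl
    (F 0 *ℤ G (suc (suc k))) (G 0 *ℤ F (suc (suc k))) (((F ∘ suc) ⋆ (G ∘ suc)) k)

⋆-comm : ∀ F G → F ⋆ G ≗ G ⋆ F
⋆-comm F G zero    = ℤ.*-comm (F 0) (G 0)
⋆-comm F G (suc k) rewrite ⋆-comm (F ∘ suc) G k | ⋆-sucʳ G F k = refl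

⋆-distribʳ-+ : ∀ F H G → (λ j → F j +ℤ H j) ⋆ G ≗ (λ k → (F ⋆ G) k +ℤ (H ⋆ G) k)
⋆-distribʳ-+ F H G zero    = ℤ.*-distribʳ-+ (G 0) (F 0) (H 0)
⋆-distribʳ-+ F H G (suc k) rewrite ⋆-distribʳ-+ (F ∘ suc) (H ∘ suc) G k =
  solve 5 (λ f h g a b → (f :+ h) :* g :+ (a :+ b) := (f :* g :+ a) :+ (h :* g :+ b)) refl
    (F 0) (H 0) (G (suc k)) (((F ∘ suc) ⋆ G) k) (((H ∘ suc) ⋆ G) k)

⋆-scaleˡ : ∀ c F G → (λ j → c *ℤ F j) ⋆ G ≗ (λ k → c *ℤ (F ⋆ G) k)
⋆-scaleˡ c F G zero    = ℤ.*-assoc c (F 0) (G 0)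
⋆-scaleˡ c F G (suc k) rewrite ⋆-scaleˡ c (F ∘ suc) G k =
  solve 4 (λ c f g a → c :* f :* g :+ c :* a := c :* (f :* g :+ a)) refl c (F 0) (G (suc k)) (((F ∘ suc) ⋆ G) k)

⋆-assoc : ∀ F G H → (F ⋆ G) ⋆ H ≗ F ⋆ (G ⋆ H)
⋆-assoc F G H zero    = ℤ.*-assoc (F 0) (G 0) (H 0)
⋆-assoc F G H (suc k) = begin
    (F 0 *ℤ G 0) *ℤ H (suc k) +ℤ ((λ j → F 0 *ℤ G (suc j) +ℤ ((F ∘ suc) ⋆ G) j) ⋆ H) k
  ≡⟨ cong ((F 0 *ℤ G 0) *ℤ H (suc k) +ℤ_) (⋆-distribʳ-+ _ _ H k) ⟩
    (F 0 *ℤ G 0) *ℤ H (suc k) +ℤ (((λ j → F 0 *ℤ G (suc j)) ⋆ H) k +ℤ (((F ∘ suc) ⋆ G) ⋆ H) k)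
  ≡⟨ cong₂ (λ a b → (F 0 *ℤ G 0) *ℤ H (suc k) +ℤ (a +ℤ b))
           (⋆-scaleˡ (F 0) (G ∘ suc) H k) (⋆-assoc (F ∘ suc) G H k) ⟩
    (F 0 *ℤ G 0) *ℤ H (suc k) +ℤ (F 0 *ℤ ((G ∘ suc) ⋆ H) k +ℤ ((F ∘ suc) ⋆ (G ⋆ H)) k)
  ≡⟨ solve 5 (λ f g h a b → f :* g :* h :+ (f :* a :+ b) := f :* (g :* h :+ a) :+ b) refl
       (F 0) (G 0) (H (suc k)) (((G ∘ suc) ⋆ H) k) (((F ∘ suc) ⋆ (G ⋆ H)) k) ⟩
    F 0 *ℤ (G 0 *ℤ H (suc k) +ℤ ((G ∘ suc) ⋆ H) k) +ℤ ((F ∘ suc) ⋆ (G ⋆ H)) k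
  ∎
  where open ≡-Reasoning

⋆-identityˡ : ∀ F → one ⋆ F ≗ F
⋆-identityˡ F zero    = ℤ.*-identityˡ (F 0)
⋆-identityˡ F (suc k) rewrite ⋆-zeroˡ {one ∘ suc} F (λ _ → refl) k =
  trans (ℤ.+-identityʳ _) (ℤ.*-identityˡ _)

⋆-identityʳ : ∀ F → F ⋆ one ≗ F
⋆-identityʳ F k = trans (⋆-comm F one k) (⋆-identityˡ F k)

⋆-commutativeMonoid : CommutativeMonoid 0ℓ 0ℓ
⋆-commutativeMonoid = record
  { Carrier = Series ; _≈_ = _≗_ ; _∙_ = _⋆_ ; ε = one
  ; isCommutativeMonoid = record
    { isMonoid = record
      { isSemigroup = record
        { isMagma = record
          { isEquivalence = Setoid.isEquivalence (ℕ →-setoid ℤ)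
          ; ∙-cong = λ {_} {G} {H} F≗G H≗K k → trans (⋆-congˡ H F≗G k) (⋆-congʳ G H≗K k) }
        ; assoc = ⋆-assoc }
      ; identity = ⋆-identityˡ , ⋆-identityʳ }
    ; comm = ⋆-comm } }

coeff-+P : ∀ f g k → coeff (f +P g) k ≡ coeff f k +ℤ coeff g k
coeff-+P []      g       k       = sym (ℤ.+-identityˡ _)
coeff-+P (a ∷ f) []      k       = sym (ℤ.+-identityʳ _)
coeff-+P (a ∷ f) (b ∷ g) zero    = refl
coeff-+P (a ∷ f) (b ∷ g) (suc k) = coeff-+P f g k

coeff-scaleP : ∀ c g k → coeff (scaleP c g) k ≡ c *ℤ coeff g k
coeff-scaleP c []      k       = sym (ℤ.*-zeroʳ c)
coeff-scaleP c (b ∷ g) zero    = refl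
coeff-scaleP c (b ∷ g) (suc k) = coeff-scaleP c g k

coeff-*P : ∀ f g → coeff (f *P g) ≗ coeff f ⋆ coeff g
coeff-*P []      g k       = sym (⋆-zeroˡ (coeff g) (λ _ → refl) k)
coeff-*P (a ∷ f) g zero    = begin
    coeff (scaleP a g +P (0ℤ ∷ (f *P g))) 0  ≡⟨ coeff-+P (scaleP a g) _ 0 ⟩
    coeff (scaleP a g) 0 +ℤ 0ℤ                ≡⟨ ℤ.+-identityʳ _ ⟩
    coeff (scaleP a g) 0                     ≡⟨ coeff-scaleP a g 0 ⟩
    a *ℤ coeff g 0                            ∎
  where open ≡-Reasoning
coeff-*P (a ∷ f) g (suc k) =
  trans (coeff-+P (scaleP a g) _ (suc k)) (cong₂ _+ℤ_ (coeff-scaleP a g (suc k)) (coeff-*P f g k))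

coeff-prodP : ∀ (Φ : ℕ → Poly) ds → coeff (prodP (map Φ ds)) ≗ foldr _⋆_ one (map (coeff ∘ Φ) ds)
coeff-prodP Φ []       zero    = refl
coeff-prodP Φ []       (suc k) = refl
coeff-prodP Φ (d ∷ ds) k       =
  trans (coeff-*P (Φ d) (prodP (map Φ ds)) k) (⋆-congʳ (coeff (Φ d)) (coeff-prodP Φ ds) k)

module RangeSum {c ℓ} (M : CommutativeMonoid c ℓ) where
  open CommutativeMonoid M renaming (refl to ≈-refl; sym to ≈-sym; trans to ≈-trans)
  open import Algebra.Properties.CommutativeMonoid.Sum M using (sum; sum-cong-≗; ∑-distrib-+; ∑-comm)
  open import Relation.Binary.Reasoning.Setoid setoid

  ∑₁ : ℕ → (ℕ → Carrier) → Carrier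
  ∑₁ zero    f = ε
  ∑₁ (suc N) f = f 1 ∙ ∑₁ N (f ∘ suc)

  ∑₁≡sum : ∀ N f → ∑₁ N f ≡ sum {N} (λ i → f (suc (toℕ i)))
  ∑₁≡sum zero    f = refl
  ∑₁≡sum (suc N) f = cong (f 1 ∙_) (∑₁≡sum N (f ∘ suc))

  ∑₁-cong : ∀ N {f g} → (∀ k → k < N → f (suc k) ≈ g (suc k)) → ∑₁ N f ≈ ∑₁ N g
  ∑₁-cong zero    f≈g = ≈-refl
  ∑₁-cong (suc N) f≈g = ∙-cong (f≈g 0 (s≤s z≤n)) (∑₁-cong N (λ k k<N → f≈g (suc k) (s≤s k<N)))

  ∑₁-ε : ∀ N {f} → (∀ k → k < N → f (suc k) ≈ ε) → ∑₁ N f ≈ ε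
  ∑₁-ε zero    f≈ε = ≈-refl
  ∑₁-ε (suc N) f≈ε =
    ≈-trans (∙-cong (f≈ε 0 (s≤s z≤n)) (∑₁-ε N (λ k k<N → f≈ε (suc k) (s≤s k<N)))) (identityˡ ε)

  ∑₁-∙ : ∀ N f g → ∑₁ N (λ k → f k ∙ g k) ≈ ∑₁ N f ∙ ∑₁ N g
  ∑₁-∙ N f g = begin
      ∑₁ N (λ k → f k ∙ g k)
    ≡⟨ ∑₁≡sum N _ ⟩
      sum {N} (λ i → f (suc (toℕ i)) ∙ g (suc (toℕ i)))
    ≈⟨ ∑-distrib-+ {N} (f ∘ suc ∘ toℕ) (g ∘ suc ∘ toℕ) ⟩
      sum {N} (λ i → f (suc (toℕ i))) ∙ sum {N} (λ i → g (suc (toℕ i)))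
    ≡⟨ sym (cong₂ _∙_ (∑₁≡sum N f) (∑₁≡sum N g)) ⟩
      ∑₁ N f ∙ ∑₁ N g
    ∎

  ∑₁-comm : ∀ M N (f : ℕ → ℕ → Carrier) → ∑₁ M (λ d → ∑₁ N (f d)) ≈ ∑₁ N (λ k → ∑₁ M (λ d → f d k))
  ∑₁-comm M N f = begin
      ∑₁ M (λ d → ∑₁ N (f d))
    ≡⟨ ∑₁≡sum² M N f ⟩
      sum {M} (λ i → sum {N} (λ j → f (suc (toℕ i)) (suc (toℕ j))))
    ≈⟨ ∑-comm {M} {N} (λ i j → f (suc (toℕ i)) (suc (toℕ j))) ⟩
      sum {N} (λ j → sum {M} (λ i → f (suc (toℕ i)) (suc (toℕ j))))
    ≡⟨ sym (∑₁≡sum² N M (λ k d → f d k)) ⟩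
      ∑₁ N (λ k → ∑₁ M (λ d → f d k))
    ∎
    where
    ∑₁≡sum² : ∀ M N (f : ℕ → ℕ → Carrier) →
      ∑₁ M (λ d → ∑₁ N (f d)) ≡ sum {M} (λ i → sum {N} (λ j → f (suc (toℕ i)) (suc (toℕ j))))
    ∑₁≡sum² M N f = trans (∑₁≡sum M _) (sum-cong-≗ {M} (λ i → ∑₁≡sum N (f (suc (toℕ i)))))

  ∑₁-+ : ∀ a b f → ∑₁ (a + b) f ≈ ∑₁ a f ∙ ∑₁ b (λ k → f (a + k))
  ∑₁-+ zero    b f = ≈-sym (identityˡ _)
  ∑₁-+ (suc a) b f = ≈-trans (∙-cong ≈-refl (∑₁-+ a b (f ∘ suc))) (≈-sym (assoc _ _ _))

  ∑₁-snoc : ∀ N f → ∑₁ (suc N) f ≈ ∑₁ N f ∙ f (suc N)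
  ∑₁-snoc zero    f = ≈-trans (identityʳ _) (≈-sym (identityˡ _))
  ∑₁-snoc (suc N) f = ≈-trans (∙-cong ≈-refl (∑₁-snoc N (f ∘ suc))) (≈-sym (assoc _ _ _))

  ∑₁-tail : ∀ a b f → (∀ j → j < b → f (a + suc j) ≈ ε) → ∑₁ (a + b) f ≈ ∑₁ a f
  ∑₁-tail a b f tail≈ε =
    ≈-trans (∑₁-+ a b f) (≈-trans (∙-cong ≈-refl (∑₁-ε b tail≈ε)) (identityʳ _))

  ∑₁-reindex : ∀ c N f → (∀ k → ¬ (suc c ∣ k) → f k ≈ ε) →
    ∑₁ (N * suc c) f ≈ ∑₁ N (λ e → f (e * suc c))
  ∑₁-reindex c zero    f off≈ε = ≈-refl
  ∑₁-reindex c (suc N) f off≈ε = begin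
      ∑₁ (suc c + N * suc c) f
    ≈⟨ ∑₁-+ (suc c) (N * suc c) f ⟩
      ∑₁ (suc c) f ∙ ∑₁ (N * suc c) (λ k → f (suc c + k))
    ≈⟨ ∙-cong first-block
         (∑₁-reindex c N _ (λ k ∤k → off≈ε _ (λ ∣c+k → ∤k (∣m+n∣m⇒∣n ∣c+k ∣-refl)))) ⟩
      f (suc c) ∙ ∑₁ N (λ e → f (suc c + e * suc c))
    ≈⟨ ∙-cong (reflexive (cong f (sym (ℕ.+-identityʳ (suc c))))) ≈-refl ⟩
      ∑₁ (suc N) (λ e → f (e * suc c))
    ∎
    where
    first-block : ∑₁ (suc c) f ≈ f (suc c)
    first-block = ≈-trans (∑₁-snoc c f)
      (≈-trans (∙-cong (∑₁-ε c (λ k k<c → off≈ε (suc k) (ℕ.<⇒≱ (s≤s k<c) ∘ ∣⇒≤))) ≈-refl)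
               (identityˡ _))

  foldr-filter-applyUpTo : ∀ {P : Pred ℕ 0ℓ} (P? : Decidable P) (g : ℕ → Carrier) f N →
    foldr _∙_ ε (map g (filter P? (applyUpTo f N)))
      ≈ sum {N} (λ i → if does (P? (f (toℕ i))) then g (f (toℕ i)) else ε)
  foldr-filter-applyUpTo P? g f zero = ≈-refl
  foldr-filter-applyUpTo P? g f (suc N) with does (P? (f 0))
  ... | true  = ∙-cong ≈-refl (foldr-filter-applyUpTo P? g (f ∘ suc) N)
  ... | false = ≈-trans (foldr-filter-applyUpTo P? g (f ∘ suc) N) (≈-sym (identityˡ _))

  foldr-filter-∑₁ : ∀ {P : Pred ℕ 0ℓ} (P? : Decidable P) (g : ℕ → Carrier) N →
    foldr _∙_ ε (map g (filter P? (map suc (upTo N)))) ≈ ∑₁ N (λ d → if does (P? d) then g d else ε)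
  foldr-filter-∑₁ P? g N rewrite map-applyUpTo id suc N =
    ≈-trans (foldr-filter-applyUpTo P? g suc N) (reflexive (sym (∑₁≡sum N _)))

if-does-yes : ∀ {a} {A : Set a} {P : Set} (P? : Dec P) {x y : A} → P → (if does P? then x else y) ≡ x
if-does-yes P? p rewrite dec-true P? p = refl

if-does-no : ∀ {a} {A : Set a} {P : Set} (P? : Dec P) {x y : A} → ¬ P → (if does P? then x else y) ≡ y
if-does-no P? ¬p rewrite dec-false P? ¬p = refl

if-does-elim : ∀ {a ℓ} {A : Set a} {P : Set} (Q : A → Set ℓ) (P? : Dec P) {x y : A} →
  (P → Q x) → Q y → Q (if does P? then x else y)
if-does-elim Q (yes p) Qx _  = Qx p
if-does-elim Q (no _)  _  Qy = Qy

if-does-⇔ : ∀ {a} {A : Set a} {P Q : Set} (P? : Dec P) (Q? : Dec Q) {x y : A} → P ⇔ Q →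
  (if does P? then x else y) ≡ (if does Q? then x else y)
if-does-⇔ P? Q? P⇔Q rewrite does-⇔ P⇔Q P? Q? = refl

𝟙 : {P : Set} → Dec P → ℕ
𝟙 P? = if does P? then 1 else 0

module ℕ-Sum = RangeSum ℕ.+-0-commutativeMonoid
open ℕ-Sum using (∑₁)

length≡foldr-ones : ∀ (xs : List ℕ) → length xs ≡ foldr _+_ 0 (map (λ _ → 1) xs)
length≡foldr-ones []       = refl
length≡foldr-ones (x ∷ xs) = cong suc (length≡foldr-ones xs)

φ≡∑₁ : ∀ n → φ n ≡ ∑₁ n (λ k → 𝟙 (gcd k n ≟ 1))
φ≡∑₁ n = trans (length≡foldr-ones (filter (λ k → gcd k n ≟ 1) (map suc (upTo n))))
               (ℕ-Sum.foldr-filter-∑₁ (λ k → gcd k n ≟ 1) (λ _ → 1) n)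

∑₁-ones : ∀ N → ∑₁ N (λ _ → 1) ≡ N
∑₁-ones zero    = refl
∑₁-ones (suc N) = cong suc (∑₁-ones N)

-- The recursion uses that `does (suc d ≟ suc e)` reduces to `does (d ≟ e)`.
∑₁-𝟙≡ : ∀ {N e} → 1 ≤ e → e ≤ N → ∑₁ N (λ d → 𝟙 (d ≟ e)) ≡ 1
∑₁-𝟙≡ {suc N} {1}           _ _           = cong suc (ℕ-Sum.∑₁-ε N (λ _ _ → refl))
∑₁-𝟙≡ {suc N} {suc (suc e)} _ (s≤s e<N) = ∑₁-𝟙≡ (s≤s z≤n) e<N

∑₁-𝟙-cofactor : ∀ g {n} .{{_ : NonZero g}} → 1 ≤ n → g ∣ n → ∑₁ n (λ d → 𝟙 (g * d ≟ n)) ≡ 1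
∑₁-𝟙-cofactor g {n} 1≤n (divides e n≡e*g) =
  trans (ℕ-Sum.∑₁-cong n (λ d _ → if-does-⇔ (g * suc d ≟ n) (suc d ≟ e) (mk⇔ cancel uncancel)))
        (∑₁-𝟙≡ 1≤e e≤n)
  where
  cancel : ∀ {d} → g * d ≡ n → d ≡ e
  cancel {d} g*d≡n = ℕ.*-cancelˡ-≡ d e g (trans g*d≡n (trans n≡e*g (ℕ.*-comm e g)))
  uncancel : ∀ {d} → d ≡ e → g * d ≡ n
  uncancel refl = trans (ℕ.*-comm g e) (sym n≡e*g)
  e≤n : e ≤ n
  e≤n = subst (e ≤_) (sym n≡e*g) (ℕ.m≤m*n e g)
  1≤e : 1 ≤ e
  1≤e = ℕ.n≢0⇒n>0 (λ e≡0 → ℕ.<⇒≢ 1≤n (sym (trans n≡e*g (cong (_* g) e≡0))))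

∑₁-gcd≡ : ∀ c d n → n ≡ d * suc c → ∑₁ n (λ k → 𝟙 (gcd k n ≟ suc c)) ≡ φ d
∑₁-gcd≡ c d .(d * suc c) refl = begin
    ∑₁ (d * C) (λ k → 𝟙 (gcd k (d * C) ≟ C))
  ≡⟨ ℕ-Sum.∑₁-reindex c d _ (λ k C∤k → if-does-no (gcd k (d * C) ≟ C)
                                         (λ gcd≡C → C∤k (subst (_∣ k) gcd≡C (gcd[m,n]∣m k _)))) ⟩
    ∑₁ d (λ e → 𝟙 (gcd (e * C) (d * C) ≟ C))
  ≡⟨ ℕ-Sum.∑₁-cong d (λ e _ → if-does-⇔ (gcd (suc e * C) (d * C) ≟ C) (gcd (suc e) d ≟ 1)
                                         (mk⇔ (cancel (suc e)) (uncancel (suc e)))) ⟩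
    ∑₁ d (λ e → 𝟙 (gcd e d ≟ 1))
  ≡⟨ sym (φ≡∑₁ d) ⟩
    φ d
  ∎
  where
  open ≡-Reasoning
  C : ℕ
  C = suc c
  gcd-scale : ∀ e → gcd (e * C) (d * C) ≡ C * gcd e d
  gcd-scale e = trans (cong₂ gcd (ℕ.*-comm e C) (ℕ.*-comm d C)) (sym (c*gcd[m,n]≡gcd[cm,cn] C e d))
  cancel : ∀ e → gcd (e * C) (d * C) ≡ C → gcd e d ≡ 1
  cancel e eq = ℕ.*-cancelˡ-≡ (gcd e d) 1 C (trans (sym (gcd-scale e)) (trans eq (sym (ℕ.*-identityʳ C))))
  uncancel : ∀ e → gcd e d ≡ 1 → gcd (e * C) (d * C) ≡ C
  uncancel e eq = trans (gcd-scale e) (trans (cong (C *_) eq) (ℕ.*-identityʳ C))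

-- Double counting the pairs (k, d) with gcd(k, n) · d = n: each k ≤ n has exactly one partner d, and for
-- d ∣ n the partners of d are the k = e · (n / d) with gcd(e, d) = 1.
gauss : ∀ n → 1 ≤ n → ∑₁ n (λ d → if does (d ∣? n) then φ d else 0) ≡ n
gauss n 1≤n = begin
    ∑₁ n (λ d → if does (d ∣? n) then φ d else 0)  ≡⟨ ℕ-Sum.∑₁-cong n (λ d _ → sym (count-for-divisor d)) ⟩
    ∑₁ n (λ d → ∑₁ n (hit d))                      ≡⟨ ℕ-Sum.∑₁-comm n n hit ⟩
    ∑₁ n (λ k → ∑₁ n (λ d → hit d k))              ≡⟨ ℕ-Sum.∑₁-cong n count-for-k ⟩
    ∑₁ n (λ _ → 1)                                 ≡⟨ ∑₁-ones n ⟩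
    n                                              ∎
  where
  open ≡-Reasoning
  hit : ℕ → ℕ → ℕ
  hit d k = 𝟙 (gcd k n * d ≟ n)
  count-for-k : ∀ k → k < n → ∑₁ n (λ d → hit d (suc k)) ≡ 1
  count-for-k k _ = ∑₁-𝟙-cofactor (gcd (suc k) n) 1≤n (gcd[m,n]∣n (suc k) n)
    where
    instance
      gcd≢0 : NonZero (gcd (suc k) n)
      gcd≢0 = ℕ.≢-nonZero (gcd[m,n]≢0 (suc k) n (inj₁ λ ()))
  count-for-divisor : ∀ d′ → ∑₁ n (hit (suc d′)) ≡ (if does (suc d′ ∣? n) then φ (suc d′) else 0)
  count-for-divisor d′ = by-cases (d ∣? n)
    where
    d : ℕ
    d = suc d′
    by-cases : (d∣?n : Dec (d ∣ n)) → ∑₁ n (hit d) ≡ (if does d∣?n then φ d else 0)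
    by-cases (yes (divides zero n≡0)) = ⊥-elim (ℕ.<⇒≢ 1≤n (sym n≡0))
    by-cases (yes (divides (suc c) n≡)) = trans
      (ℕ-Sum.∑₁-cong n (λ k _ →
        if-does-⇔ (gcd (suc k) n * d ≟ n) (gcd (suc k) n ≟ suc c) (mk⇔ cancel uncancel)))
      (∑₁-gcd≡ c d n (trans n≡ (ℕ.*-comm (suc c) d)))
      where
      cancel : ∀ {g} → g * d ≡ n → g ≡ suc c
      cancel {g} eq = ℕ.*-cancelʳ-≡ g (suc c) d (trans eq n≡)
      uncancel : ∀ {g} → g ≡ suc c → g * d ≡ n
      uncancel refl = sym n≡
    by-cases (no d∤n) = ℕ-Sum.∑₁-ε n (λ k _ →
      if-does-no (gcd (suc k) n * d ≟ n) (λ eq → d∤n (divides (gcd (suc k) n) (sym eq))))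

prime∤-∣m*p⇒∣m : ∀ {p d m} → Prime p → ¬ (p ∣ d) → d ∣ m * p → d ∣ m
prime∤-∣m*p⇒∣m {p} {d} {m} p-prime p∤d d∣m*p = coprime-divisor d⊥p (subst (d ∣_) (ℕ.*-comm m p) d∣m*p)
  where
  d⊥p : Coprime d p
  d⊥p (i∣d , i∣p) = [ id , (λ { refl → ⊥-elim (p∤d i∣d) }) ]′ (prime⇒irreducible p-prime i∣p)

*ℤ-≢0 : ∀ {a b} → a ≢ 0ℤ → b ≢ 0ℤ → a *ℤ b ≢ 0ℤ
*ℤ-≢0 {a} a≢0 b≢0 ab≡0 = [ a≢0 , b≢0 ]′ (ℤ.i*j≡0⇒i≡0∨j≡0 a ab≡0)

*ℤ-≢0ˡ : ∀ {a b} → a *ℤ b ≢ 0ℤ → a ≢ 0ℤ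
*ℤ-≢0ˡ ab≢0 refl = ab≢0 refl

*ℤ-≢0ʳ : ∀ {a b} → a *ℤ b ≢ 0ℤ → b ≢ 0ℤ
*ℤ-≢0ʳ {a} ab≢0 refl = ab≢0 (ℤ.*-zeroʳ a)

⋆-top : ∀ {F G} a b → (∀ k → a < k → F k ≡ 0ℤ) → (∀ k → b < k → G k ≡ 0ℤ) →
  (F ⋆ G) (a + b) ≡ F a *ℤ G b
⋆-top zero    zero    F-high G-high = refl
⋆-top {F} {G} zero (suc b) F-high G-high =
  trans (cong (F 0 *ℤ G (suc b) +ℤ_) (⋆-zeroˡ G (λ j → F-high (suc j) (s≤s z≤n)) b)) (ℤ.+-identityʳ _)
⋆-top {F} {G} (suc a) b F-high G-high = begin
    F 0 *ℤ G (suc (a + b)) +ℤ ((F ∘ suc) ⋆ G) (a + b)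
  ≡⟨ cong₂ _+ℤ_ (cong (F 0 *ℤ_) (G-high _ (s≤s (ℕ.m≤n+m b a))))
                (⋆-top a b (λ k a<k → F-high (suc k) (s≤s a<k)) G-high) ⟩
    F 0 *ℤ 0ℤ +ℤ F (suc a) *ℤ G b
  ≡⟨ cong (_+ℤ F (suc a) *ℤ G b) (ℤ.*-zeroʳ (F 0)) ⟩
    0ℤ +ℤ F (suc a) *ℤ G b
  ≡⟨ ℤ.+-identityˡ _ ⟩
    F (suc a) *ℤ G b
  ∎
  where open ≡-Reasoning

⋆-vanishes-above : ∀ {F G} a b → (∀ k → a < k → F k ≡ 0ℤ) → (∀ k → b < k → G k ≡ 0ℤ) →
  ∀ k → a + b < k → (F ⋆ G) k ≡ 0ℤ
⋆-vanishes-above {F} {G} a b F-high G-high k a+b<k = ⋆-vanishes F G k term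
  where
  term : ∀ i → i ≤ k → F i *ℤ G (k ∸ i) ≡ 0ℤ
  term i _ with a ℕ.<? i
  ... | yes a<i = cong (_*ℤ G (k ∸ i)) (F-high i a<i)
  ... | no a≮i  = trans (cong (F i *ℤ_) (G-high (k ∸ i) b<k∸i)) (ℤ.*-zeroʳ (F i))
    where
    b<k∸i : b < k ∸ i
    b<k∸i = ℕ.m+n≤o⇒m≤o∸n (suc b)
      (ℕ.≤-trans (ℕ.+-monoʳ-≤ (suc b) (ℕ.≮⇒≥ a≮i)) (subst (λ x → suc x ≤ k) (ℕ.+-comm a b) a+b<k))

⋆-single-term : ∀ {F G} a n → (∀ k → a < k → F k ≡ 0ℤ) → (∀ j → 1 ≤ j → j ≤ a → G (n ∸ j) ≡ 0ℤ) →
  (F ⋆ G) n ≡ F 0 *ℤ G n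
⋆-single-term a zero    _      _     = refl
⋆-single-term {F} {G} a (suc n) F-high G-low =
  trans (cong (F 0 *ℤ G (suc n) +ℤ_) (⋆-vanishes (F ∘ suc) G n term)) (ℤ.+-identityʳ _)
  where
  term : ∀ i → i ≤ n → F (suc i) *ℤ G (n ∸ i) ≡ 0ℤ
  term i _ with a ℕ.<? suc i
  ... | yes a<1+i = cong (_*ℤ G (n ∸ i)) (F-high (suc i) a<1+i)
  ... | no a≮1+i  =
    trans (cong (F (suc i) *ℤ_) (G-low (suc i) (s≤s z≤n) (ℕ.≮⇒≥ a≮1+i))) (ℤ.*-zeroʳ (F (suc i)))

isDeg-⋆ : ∀ {F G a b} → IsDeg F a → IsDeg G b → IsDeg (F ⋆ G) (a + b)
isDeg-⋆ {a = a} {b} (Fa≢0 , F-high) (Gb≢0 , G-high) =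
  (λ eq → *ℤ-≢0 Fa≢0 Gb≢0 (trans (sym (⋆-top a b F-high G-high)) eq)) , ⋆-vanishes-above a b F-high G-high

isDeg-unique : ∀ {F a b} → IsDeg F a → IsDeg F b → a ≡ b
isDeg-unique {a = a} {b} (Fa≢0 , F-high-a) (Fb≢0 , F-high-b) with ℕ.<-cmp a b
... | tri< a<b _ _ = ⊥-elim (Fb≢0 (F-high-a b a<b))
... | tri≈ _ a≡b _ = a≡b
... | tri> _ _ b<a = ⊥-elim (Fa≢0 (F-high-b a b<a))

isDeg-cong : ∀ {F G d} → F ≗ G → IsDeg F d → IsDeg G d
isDeg-cong F≗G (Fd≢0 , F-high) =
  (λ Gd≡0 → Fd≢0 (trans (F≗G _) Gd≡0)) , (λ k d<k → trans (sym (F≗G k)) (F-high k d<k))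

isDeg-one : IsDeg one 0
isDeg-one = (λ ()) , λ { (suc k) _ → refl }

coeff-zero-or-isDeg : ∀ (f : Poly) → (∀ k → coeff f k ≡ 0ℤ) ⊎ Σ[ d ∈ ℕ ] IsDeg (coeff f) d
coeff-zero-or-isDeg []      = inj₁ (λ _ → refl)
coeff-zero-or-isDeg (a ∷ f) with coeff-zero-or-isDeg f
... | inj₂ (d , f[d]≢0 , f-high) = inj₂ (suc d , f[d]≢0 , λ { (suc k) d<k → f-high k (ℕ.≤-pred d<k) })
... | inj₁ f≡0 with a ℤ.≟ 0ℤ
...   | yes a≡0 = inj₁ λ { zero → a≡0 ; (suc k) → f≡0 k }
...   | no a≢0  = inj₂ (0 , a≢0 , λ { (suc k) _ → f≡0 k })

isDeg-⋆-cancelʳ : ∀ (f : Poly) {G D e} → IsDeg (coeff f ⋆ G) D → IsDeg G e → IsDeg (coeff f) (D ∸ e)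
isDeg-⋆-cancelʳ f {G} {D} {e} fG-deg G-deg with coeff-zero-or-isDeg f
... | inj₁ f≡0       = ⊥-elim (proj₁ fG-deg (⋆-zeroˡ G f≡0 D))
... | inj₂ (d , f-deg) = subst (IsDeg (coeff f)) d≡D∸e f-deg
  where
  d≡D∸e : d ≡ D ∸ e
  d≡D∸e = trans (sym (ℕ.m+n∸n≡m d e)) (cong (_∸ e) (isDeg-unique (isDeg-⋆ f-deg G-deg) fG-deg))

Sparse : ℕ → Series → Set
Sparse p F = ∀ k → ¬ (p ∣ k) → F k ≡ 0ℤ

sparse-one : ∀ {p} → Sparse p one
sparse-one {p} zero    p∤0 = ⊥-elim (p∤0 (p ∣0))
sparse-one     (suc k) _   = refl

sparse-cong : ∀ {p F G} → F ≗ G → Sparse p F → Sparse p G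
sparse-cong F≗G F-sparse k p∤k = trans (sym (F≗G k)) (F-sparse k p∤k)

sparse-⋆ : ∀ {p F G} → Sparse p F → Sparse p G → Sparse p (F ⋆ G)
sparse-⋆ {p} {F} {G} F-sparse G-sparse k p∤k = ⋆-vanishes F G k term
  where
  term : ∀ i → i ≤ k → F i *ℤ G (k ∸ i) ≡ 0ℤ
  term i i≤k with p ∣? i
  ... | no p∤i  = cong (_*ℤ G (k ∸ i)) (F-sparse i p∤i)
  ... | yes p∣i = trans (cong (F i *ℤ_) (G-sparse (k ∸ i) (λ p∣k∸i → p∤k (∣m∸n∣n⇒∣m p i≤k p∣k∸i p∣i))))
                        (ℤ.*-zeroʳ (F i))

-- Strong induction on k: (B ⋆ A) (k + 1) = B 0 · A (k + 1) + ∑ B (i + 1) · A (k - i), and each term of the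
-- sum vanishes by sparsity of B or by the induction hypothesis.
sparse-⋆-cancelʳ : ∀ {p A B} → Sparse p (A ⋆ B) → Sparse p B → B 0 ≢ 0ℤ → Sparse p A
sparse-⋆-cancelʳ {p} {A} {B} AB-sparse B-sparse B0≢0 = <-rec (λ k → ¬ (p ∣ k) → A k ≡ 0ℤ) step
  where
  step : ∀ k → (∀ {j} → j < k → ¬ (p ∣ j) → A j ≡ 0ℤ) → ¬ (p ∣ k) → A k ≡ 0ℤ
  step zero    _  p∤0  = ⊥-elim (p∤0 (p ∣0))
  step (suc k) IH p∤1+k = [ ⊥-elim ∘ B0≢0 , id ]′ (ℤ.i*j≡0⇒i≡0∨j≡0 (B 0) B0*A[1+k]≡0)
    where
    term : ∀ i → i ≤ k → B (suc i) *ℤ A (k ∸ i) ≡ 0ℤ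
    term i i≤k with p ∣? suc i
    ... | no p∤1+i  = cong (_*ℤ A (k ∸ i)) (B-sparse (suc i) p∤1+i)
    ... | yes p∣1+i = trans (cong (B (suc i) *ℤ_) (IH (s≤s (ℕ.m∸n≤m k i))
                        (λ p∣k∸i → p∤1+k (∣m∸n∣n⇒∣m p (s≤s i≤k) p∣k∸i p∣1+i)))) (ℤ.*-zeroʳ (B (suc i)))
    B0*A[1+k]≡0 : B 0 *ℤ A (suc k) ≡ 0ℤ
    B0*A[1+k]≡0 = begin
      B 0 *ℤ A (suc k)        ≡⟨ ℤ.+-identityʳ _ ⟨
      B 0 *ℤ A (suc k) +ℤ 0ℤ  ≡⟨ cong (B 0 *ℤ A (suc k) +ℤ_) (⋆-vanishes (B ∘ suc) A k term) ⟨
      (B ⋆ A) (suc k)         ≡⟨ ⋆-comm B A (suc k) ⟩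
      (A ⋆ B) (suc k)         ≡⟨ AB-sparse (suc k) p∤1+k ⟩
      0ℤ                      ∎
      where open ≡-Reasoning

open RangeSum ⋆-commutativeMonoid using () renaming
  ( ∑₁ to ∏₁; ∑₁-cong to ∏₁-cong; ∑₁-∙ to ∏₁-⋆; ∑₁-snoc to ∏₁-snoc; ∑₁-tail to ∏₁-tail
  ; ∑₁-reindex to ∏₁-reindex; foldr-filter-∑₁ to foldr-filter-∏₁ )

if-does-⋆ : ∀ {P : Set} (P? : Dec P) {F G : Series} →
  (if does P? then F else one) ⋆ (if does P? then G else one) ≗ (if does P? then F ⋆ G else one)
if-does-⋆ (yes _) k = refl
if-does-⋆ (no _)  k = ⋆-identityˡ one k

sparse-∏₁ : ∀ {p} N f → (∀ k → k < N → Sparse p (f (suc k))) → Sparse p (∏₁ N f)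
sparse-∏₁ zero    f _        = sparse-one
sparse-∏₁ (suc N) f f-sparse =
  sparse-⋆ (f-sparse 0 (s≤s z≤n)) (sparse-∏₁ N (f ∘ suc) (λ k k<N → f-sparse (suc k) (s≤s k<N)))

isDeg-∏₁ : ∀ N f δ → (∀ k → k < N → IsDeg (f (suc k)) (δ (suc k))) → IsDeg (∏₁ N f) (∑₁ N δ)
isDeg-∏₁ zero    f δ _     = isDeg-one
isDeg-∏₁ (suc N) f δ f-deg =
  isDeg-⋆ (f-deg 0 (s≤s z≤n)) (isDeg-∏₁ N (f ∘ suc) (δ ∘ suc) (λ k k<N → f-deg (suc k) (s≤s k<N)))

∏₁-const≢0 : ∀ N f → (∀ k → k < N → f (suc k) 0 ≢ 0ℤ) → ∏₁ N f 0 ≢ 0ℤ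
∏₁-const≢0 zero    f _      = λ ()
∏₁-const≢0 (suc N) f f0≢0 =
  *ℤ-≢0 (f0≢0 0 (s≤s z≤n)) (∏₁-const≢0 N (f ∘ suc) (λ k k<N → f0≢0 (suc k) (s≤s k<N)))

∏₁-const≢0⁻¹ : ∀ N f → ∏₁ N f 0 ≢ 0ℤ → ∀ k → k < N → f (suc k) 0 ≢ 0ℤ
∏₁-const≢0⁻¹ (suc N) f ∏≢0 zero    _         = *ℤ-≢0ˡ ∏≢0
∏₁-const≢0⁻¹ (suc N) f ∏≢0 (suc k) (s≤s k<N) =
  ∏₁-const≢0⁻¹ N (f ∘ suc) (*ℤ-≢0ʳ {f 1 0} ∏≢0) k k<N

coeff-xpow-≡ : ∀ n → coeff (xpow n) n ≡ 1ℤ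
coeff-xpow-≡ zero    = refl
coeff-xpow-≡ (suc n) = coeff-xpow-≡ n

coeff-xpow-≢ : ∀ n k → k ≢ n → coeff (xpow n) k ≡ 0ℤ
coeff-xpow-≢ zero    zero    k≢n = ⊥-elim (k≢n refl)
coeff-xpow-≢ zero    (suc k) _   = refl
coeff-xpow-≢ (suc n) zero    _   = refl
coeff-xpow-≢ (suc n) (suc k) k≢n = coeff-xpow-≢ n k (k≢n ∘ cong suc)

coeff-xpow-1-≢ : ∀ n k → k ≢ 0 → k ≢ n → coeff (xpow-1 n) k ≡ 0ℤ
coeff-xpow-1-≢ n zero    k≢0 _   = ⊥-elim (k≢0 refl)
coeff-xpow-1-≢ n (suc k) _   k≢n =
  trans (coeff-+P (xpow n) (-1ℤ ∷ []) (suc k)) (cong (_+ℤ 0ℤ) (coeff-xpow-≢ n (suc k) k≢n))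

isDeg-xpow-1 : ∀ n → 1 ≤ n → IsDeg (coeff (xpow-1 n)) n
isDeg-xpow-1 n@(suc _) _ =
  (λ top≡0 → 1ℤ≢0ℤ (trans (sym top≡1) top≡0)) ,
  (λ k n<k → coeff-xpow-1-≢ n k (λ { refl → ℕ.n≮0 n<k }) (ℕ.<⇒≢ n<k ∘ sym))
  where
  top≡1 : coeff (xpow-1 n) n ≡ 1ℤ
  top≡1 = trans (coeff-+P (xpow n) (-1ℤ ∷ []) n) (cong (_+ℤ 0ℤ) (coeff-xpow-≡ n))
  1ℤ≢0ℤ : 1ℤ ≢ 0ℤ
  1ℤ≢0ℤ ()

sparse-xpow-1 : ∀ p n → p ∣ n → Sparse p (coeff (xpow-1 n))
sparse-xpow-1 p n p∣n k p∤k = coeff-xpow-1-≢ n k (λ { refl → p∤k (p ∣0) }) (λ { refl → p∤k p∣n })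

module Cyclotomic (Φ : ℕ → Poly) (isCyc : IsCyclotomic Φ) where

  Φₛ : ℕ → Series
  Φₛ n = coeff (Φ n)

  factor : ℕ → ℕ → Series
  factor n d = if does (d ∣? n) then Φₛ d else one

  factor-self : ∀ n → factor n n ≗ Φₛ n
  factor-self n = cong-app (if-does-yes (n ∣? n) {Φₛ n} {one} ∣-refl)

  ∏₁-factor≗xpow-1 : ∀ n → 1 ≤ n → ∏₁ n (factor n) ≗ coeff (xpow-1 n)
  ∏₁-factor≗xpow-1 n 1≤n k = begin
    ∏₁ n (factor n) k                                    ≡⟨ foldr-filter-∏₁ (_∣? n) Φₛ n k ⟨
    foldr _⋆_ one (map Φₛ (filter (_∣? n) (map suc (upTo n)))) k ≡⟨ coeff-prodP Φ (divisors n) k ⟨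
    coeff (prodP (map Φ (divisors n))) k                 ≡⟨ isCyc n 1≤n k ⟩
    coeff (xpow-1 n) k                                   ∎
    where open ≡-Reasoning

  Φ-const≢0 : ∀ n → 1 ≤ n → Φₛ n 0 ≢ 0ℤ
  Φ-const≢0 n@(suc n′) 1≤n Φₙ0≡0 =
    ∏₁-const≢0⁻¹ n (factor n) (λ ∏0≡0 → -1≢0 (trans (sym (∏₁-factor≗xpow-1 n 1≤n 0)) ∏0≡0))
      n′ ℕ.≤-refl (trans (factor-self n 0) Φₙ0≡0)
    where
    -1≢0 : -1ℤ ≢ 0ℤ
    -1≢0 ()

  -- Strong induction: x^n - 1 = Φ n ⋆ ∏_{d ∣ n, d < n} Φ d, and Gauss's identity turns the degree
  -- count into φ n.
  Φ-deg : ∀ n → 1 ≤ n → IsDeg (Φₛ n) (φ n)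
  Φ-deg = <-rec (λ n → 1 ≤ n → IsDeg (Φₛ n) (φ n)) step
    where
    step : ∀ n → (∀ {d} → d < n → 1 ≤ d → IsDeg (Φₛ d) (φ d)) → 1 ≤ n → IsDeg (Φₛ n) (φ n)
    step n@(suc n′) IH 1≤n = subst (IsDeg (Φₛ n)) n∸∑≡φ (isDeg-⋆-cancelʳ (Φ n) ΦB-deg B-deg)
      where
      δ : ℕ → ℕ
      δ d = if does (d ∣? n) then φ d else 0
      B : Series
      B = ∏₁ n′ (factor n)
      B-deg : IsDeg B (∑₁ n′ δ)
      B-deg = isDeg-∏₁ n′ (factor n) δ (λ k k<n′ → factor-deg (suc k ∣? n) (IH (s≤s k<n′) (s≤s z≤n)))
        where
        factor-deg : ∀ {d} (d∣?n : Dec (d ∣ n)) → IsDeg (Φₛ d) (φ d) →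
          IsDeg (if does d∣?n then Φₛ d else one) (if does d∣?n then φ d else 0)
        factor-deg (yes _) Φ-deg = Φ-deg
        factor-deg (no _)  _     = isDeg-one
      ΦB-deg : IsDeg (Φₛ n ⋆ B) n
      ΦB-deg = isDeg-cong xpow-1≗ΦB (isDeg-xpow-1 n 1≤n)
        where
        xpow-1≗ΦB : coeff (xpow-1 n) ≗ Φₛ n ⋆ B
        xpow-1≗ΦB k = begin
          coeff (xpow-1 n) k        ≡⟨ ∏₁-factor≗xpow-1 n 1≤n k ⟨
          ∏₁ n (factor n) k         ≡⟨ ∏₁-snoc n′ (factor n) k ⟩
          (B ⋆ factor n n) k        ≡⟨ ⋆-congʳ B (factor-self n) k ⟩
          (B ⋆ Φₛ n) k              ≡⟨ ⋆-comm B (Φₛ n) k ⟩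
          (Φₛ n ⋆ B) k              ∎
          where open ≡-Reasoning
      n∸∑≡φ : n ∸ ∑₁ n′ δ ≡ φ n
      n∸∑≡φ = begin
        n ∸ ∑₁ n′ δ                 ≡⟨ cong (_∸ ∑₁ n′ δ) (gauss n 1≤n) ⟨
        ∑₁ n δ ∸ ∑₁ n′ δ            ≡⟨ cong (_∸ ∑₁ n′ δ) (ℕ-Sum.∑₁-snoc n′ δ) ⟩
        ∑₁ n′ δ + δ n ∸ ∑₁ n′ δ     ≡⟨ ℕ.m+n∸m≡n (∑₁ n′ δ) (δ n) ⟩
        δ n                         ≡⟨ if-does-yes (n ∣? n) ∣-refl ⟩
        φ n                         ∎
        where open ≡-Reasoning

  module _ {p′ : ℕ} (p-prime : Prime (suc p′)) where

    private
      p : ℕ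
      p = suc p′

    factorₚ : ℕ → ℕ → Series
    factorₚ m e = if does (e ∣? m) then Φₛ (e * p) else one

    pMultipleFactor : ℕ → ℕ → Series
    pMultipleFactor m d = if does (p ∣? d) then factor (m * p) d else one

    pairFactor : ℕ → ℕ → Series
    pairFactor m e = if does (e ∣? m) then Φₛ e ⋆ Φₛ (e * p) else one

    -- A divisor d of m p is either prime to p, hence a divisor of m, or a multiple of p, hence not a
    -- divisor of m < p.
    factor-split : ∀ m d .{{_ : NonZero m}} .{{_ : NonZero d}} → m < p →
      factor (m * p) d ≗ factor m d ⋆ pMultipleFactor m d
    factor-split m d m<p = by-cases (p ∣? d) (d ∣? m)
      where
      by-cases : (p∣?d : Dec (p ∣ d)) (d∣?m : Dec (d ∣ m)) →
        factor (m * p) d ≗ (if does d∣?m then Φₛ d else one) ⋆ (if does p∣?d then factor (m * p) d else one)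
      by-cases (yes p∣d) (yes d∣m) = ⊥-elim (ℕ.<⇒≱ m<p (ℕ.≤-trans (∣⇒≤ p∣d) (∣⇒≤ d∣m)))
      by-cases (yes p∣d) (no _)    = λ k → sym (⋆-identityˡ _ k)
      by-cases (no p∤d)  d∣?m      = λ k → trans
        (cong-app (if-does-⇔ (d ∣? m * p) d∣?m {Φₛ d} {one}
                    (mk⇔ (prime∤-∣m*p⇒∣m p-prime p∤d) (λ d∣m → ∣-trans d∣m (m∣m*n p)))) k)
        (sym (⋆-identityʳ _ k))

    xpow-1≗∏₁-pairFactor : ∀ m .{{_ : NonZero m}} → m < p → coeff (xpow-1 (m * p)) ≗ ∏₁ m (pairFactor m)
    xpow-1≗∏₁-pairFactor m m<p k = begin
        coeff (xpow-1 (m * p)) k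
      ≡⟨ ∏₁-factor≗xpow-1 (m * p) (ℕ.≤-trans (ℕ.>-nonZero⁻¹ m) (ℕ.m≤m*n m p)) k ⟨
        ∏₁ (m * p) (factor (m * p)) k
      ≡⟨ ∏₁-cong (m * p) (λ d _ → factor-split m (suc d) m<p) k ⟩
        ∏₁ (m * p) (λ d → factor m d ⋆ pMultipleFactor m d) k
      ≡⟨ ∏₁-⋆ (m * p) (factor m) (pMultipleFactor m) k ⟩
        (∏₁ (m * p) (factor m) ⋆ ∏₁ (m * p) (pMultipleFactor m)) k
      ≡⟨ ⋆-congˡ _ non-divisors-above-m k ⟩
        (∏₁ m (factor m) ⋆ ∏₁ (m * p) (pMultipleFactor m)) k
      ≡⟨ ⋆-congʳ _ reindex-multiples-of-p k ⟩
        (∏₁ m (factor m) ⋆ ∏₁ m (factorₚ m)) k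
      ≡⟨ ∏₁-⋆ m (factor m) (factorₚ m) k ⟨
        ∏₁ m (λ e → factor m e ⋆ factorₚ m e) k
      ≡⟨ ∏₁-cong m (λ e _ → if-does-⋆ (suc e ∣? m)) k ⟩
        ∏₁ m (pairFactor m) k
      ∎
      where
      open ≡-Reasoning
      non-divisors-above-m : ∏₁ (m * p) (factor m) ≗ ∏₁ m (factor m)
      non-divisors-above-m j = trans (cong (λ N → ∏₁ N (factor m) j) (sym (ℕ.m+[n∸m]≡n (ℕ.m≤m*n m p))))
        (∏₁-tail m (m * p ∸ m) (factor m)
          (λ i _ → cong-app (if-does-no (m + suc i ∣? m) (ℕ.m+1+n≰m m ∘ ∣⇒≤))) j)
      reindex-multiples-of-p : ∏₁ (m * p) (pMultipleFactor m) ≗ ∏₁ m (factorₚ m)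
      reindex-multiples-of-p j = trans
        (∏₁-reindex p′ m (pMultipleFactor m) (λ d p∤d → cong-app (if-does-no (p ∣? d) p∤d)) j)
        (∏₁-cong m (λ e _ → cong-app (trans
          (if-does-yes (p ∣? suc e * p) (n∣m*n (suc e)))
          (if-does-⇔ (suc e * p ∣? m * p) (suc e ∣? m) (mk⇔ (*-cancelʳ-∣ p) (*-monoˡ-∣ p))))) j)

    -- x^(mp) - 1 is a polynomial in x^p; cancelling from it the factors Φ e ⋆ Φ (e p) with e ∣ m, e < m,
    -- which are p-sparse by induction and have nonzero constant terms, leaves Φ m ⋆ Φ (m p).
    sparse-Φ⋆Φ : ∀ m → 1 ≤ m → m < p → Sparse p (Φₛ m ⋆ Φₛ (m * p))
    sparse-Φ⋆Φ = <-rec (λ m → 1 ≤ m → m < p → Sparse p (Φₛ m ⋆ Φₛ (m * p))) step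
      where
      step : ∀ m → (∀ {e} → e < m → 1 ≤ e → e < p → Sparse p (Φₛ e ⋆ Φₛ (e * p))) →
        1 ≤ m → m < p → Sparse p (Φₛ m ⋆ Φₛ (m * p))
      step m@(suc m′) IH _ m<p = sparse-⋆-cancelʳ ΦΦR-sparse R-sparse R0≢0
        where
        R : Series
        R = ∏₁ m′ (pairFactor m)
        xpow-1≗ΦΦR : coeff (xpow-1 (m * p)) ≗ (Φₛ m ⋆ Φₛ (m * p)) ⋆ R
        xpow-1≗ΦΦR k = begin
          coeff (xpow-1 (m * p)) k     ≡⟨ xpow-1≗∏₁-pairFactor m m<p k ⟩
          ∏₁ m (pairFactor m) k        ≡⟨ ∏₁-snoc m′ (pairFactor m) k ⟩
          (R ⋆ pairFactor m m) k       ≡⟨ ⋆-congʳ R (cong-app (if-does-yes (m ∣? m) ∣-refl)) k ⟩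
          (R ⋆ (Φₛ m ⋆ Φₛ (m * p))) k  ≡⟨ ⋆-comm R _ k ⟩
          ((Φₛ m ⋆ Φₛ (m * p)) ⋆ R) k  ∎
          where open ≡-Reasoning
        ΦΦR-sparse : Sparse p ((Φₛ m ⋆ Φₛ (m * p)) ⋆ R)
        ΦΦR-sparse = sparse-cong xpow-1≗ΦΦR (sparse-xpow-1 p (m * p) (n∣m*n m))
        R-sparse : Sparse p R
        R-sparse = sparse-∏₁ m′ (pairFactor m) (λ k k<m′ →
          if-does-elim (Sparse p) (suc k ∣? m) {Φₛ (suc k) ⋆ Φₛ (suc k * p)} {one}
            (λ _ → IH (s≤s k<m′) (s≤s z≤n) (ℕ.<-trans (s≤s k<m′) m<p)) sparse-one)
        R0≢0 : R 0 ≢ 0ℤ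
        R0≢0 = ∏₁-const≢0 m′ (pairFactor m) (λ k _ →
          if-does-elim (λ F → F 0 ≢ 0ℤ) (suc k ∣? m) {Φₛ (suc k) ⋆ Φₛ (suc k * p)} {one}
            (λ _ → *ℤ-≢0 (Φ-const≢0 (suc k) (s≤s z≤n)) (Φ-const≢0 (suc k * p) (s≤s z≤n))) (λ ()))

block-support : ∀ Φ m p i j l → block Φ m p i j l ≢ 0ℤ → l < m × j * m + l < p
block-support Φ m p i j l block≢0 with l ℕ.<ᵇ m in l<ᵇm | j * m + l ℕ.<ᵇ p in jm+l<ᵇp
... | true  | true  = ℕ.<ᵇ⇒< l m (subst T (sym l<ᵇm) _) , ℕ.<ᵇ⇒< (j * m + l) p (subst T (sym jm+l<ᵇp) _)
... | true  | false = ⊥-elim (block≢0 refl)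
... | false | _     = ⊥-elim (block≢0 refl)

block-coeff : ∀ Φ m p i j l → l < m → j * m + l < p →
  block Φ m p i j l ≡ coeff (Φ (m * p)) (i * p + (j * m + l))
block-coeff Φ m p i j l l<m jm+l<p
  rewrite Equivalence.to T-≡ (ℕ.<⇒<ᵇ l<m) | Equivalence.to T-≡ (ℕ.<⇒<ᵇ jm+l<p) = refl

block-gap : ∀ Φ m p i {t d} → m < p → IsTdeg (block Φ m p i 1) t → IsDeg (block Φ m p i 0) d →
  ∀ s → d < s → s < m + t → coeff (Φ (m * p)) (i * p + s) ≡ 0ℤ
block-gap Φ m p i {t} m<p (t≢0 , below-t) (_ , above-d) s d<s s<m+t with s ℕ.<? m
... | yes s<m = trans (sym (block-coeff Φ m p i 0 s s<m (ℕ.<-trans s<m m<p))) (above-d s d<s)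
... | no s≮m  = begin
    coeff (Φ (m * p)) (i * p + s)            ≡⟨ cong (λ x → coeff (Φ (m * p)) (i * p + x)) m+l≡s ⟨
    coeff (Φ (m * p)) (i * p + (1 * m + l))  ≡⟨ block-coeff Φ m p i 1 l (ℕ.<-trans l<t t<m) m+l<p ⟨
    block Φ m p i 1 l                        ≡⟨ below-t l l<t ⟩
    0ℤ                                       ∎
  where
  open ≡-Reasoning
  l : ℕ
  l = s ∸ m
  t<m : t < m
  t<m = proj₁ (block-support Φ m p i 1 t t≢0)
  m≤s : m ≤ s
  m≤s = ℕ.≮⇒≥ s≮m
  m+l≡s : 1 * m + l ≡ s
  m+l≡s = trans (cong (_+ l) (ℕ.*-identityˡ m)) (ℕ.m+[n∸m]≡n m≤s)
  l<t : l < t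
  l<t = subst (l <_) (ℕ.m+n∸m≡n m t) (ℕ.∸-monoˡ-< s<m+t m≤s)
  m+l<p : 1 * m + l < p
  m+l<p = ℕ.≤-<-trans (ℕ.+-monoʳ-≤ (1 * m) (ℕ.<⇒≤ l<t)) (proj₂ (block-support Φ m p i 1 t t≢0))

tdeg-block₁ : ∀ Φ m p i {t} → IsTdeg (block Φ m p i 1) t →
  m + t < p × coeff (Φ (m * p)) (i * p + (m + t)) ≢ 0ℤ
tdeg-block₁ Φ m p i {t} (t≢0 , _) = subst (_< p) 1m+t≡m+t m+t<p , coeff≢0
  where
  1m+t≡m+t : 1 * m + t ≡ m + t
  1m+t≡m+t = cong (_+ t) (ℕ.*-identityˡ m)
  t<m : t < m
  t<m = proj₁ (block-support Φ m p i 1 t t≢0)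
  m+t<p : 1 * m + t < p
  m+t<p = proj₂ (block-support Φ m p i 1 t t≢0)
  coeff≢0 : coeff (Φ (m * p)) (i * p + (m + t)) ≢ 0ℤ
  coeff≢0 coeff≡0 = t≢0 (trans (block-coeff Φ m p i 1 t t<m m+t<p)
                              (trans (cong (λ x → coeff (Φ (m * p)) (i * p + x)) 1m+t≡m+t) coeff≡0))

block-gap-below : ∀ Φ m p i {t d a} → m < p → IsTdeg (block Φ m p i 1) t → IsDeg (block Φ m p i 0) d →
  a < m + t ∸ d → ∀ j → 1 ≤ j → j ≤ a → coeff (Φ (m * p)) (i * p + (m + t) ∸ j) ≡ 0ℤ
block-gap-below Φ m p i {t} {d} m<p t-tdeg d-deg a<gap j 1≤j j≤a =
  trans (cong (coeff (Φ (m * p))) (ℕ.+-∸-assoc (i * p) j≤m+t))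
    (block-gap Φ m p i m<p t-tdeg d-deg (m + t ∸ j) d<m+t∸j (ℕ.∸-monoʳ-< 1≤j j≤m+t))
  where
  d≤m+t : d ≤ m + t
  d≤m+t = ℕ.≤-trans (ℕ.<⇒≤ (proj₁ (block-support Φ m p i 0 d (proj₁ d-deg)))) (ℕ.m≤m+n m t)
  j+d<m+t : j + d < m + t
  j+d<m+t = ℕ.m≤o∸n⇒m+n≤o (suc j) d≤m+t (ℕ.≤-<-trans j≤a a<gap)
  j≤m+t : j ≤ m + t
  j≤m+t = ℕ.≤-trans (ℕ.m≤m+n j d) (ℕ.<⇒≤ j+d<m+t)
  d<m+t∸j : d < m + t ∸ j
  d<m+t∸j = ℕ.m+n≤o⇒m≤o∸n (suc d) (subst (λ x → suc x ≤ m + t) (ℕ.+-comm j d) j+d<m+t)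

mainTheorem9 : (Φ : ℕ → Poly) → IsCyclotomic Φ →
    (m p : ℕ) .{{_ : NonZero m}} → Prime p → m < p →
    ∀ i → i < φ m → 2 ≤ p / m →
    ∀ t d → IsTdeg (block Φ m p i 1) t → IsDeg (block Φ m p i 0) d →
    m + t ∸ d ≤ φ m
mainTheorem9 Φ isCyc zero _ _ _ _ _ _ _ _ (t≢0 , _) _ = ⊥-elim (t≢0 refl)
mainTheorem9 Φ isCyc m@(suc _) p@(suc _) p-prime m<p i _ _ t d t-tdeg d-deg =
  ℕ.≮⇒≥ λ φm<gap → *ℤ-≢0 (Φ-const≢0 m (s≤s z≤n)) Φₘₚ[N]≢0 (begin
    Φₛ m 0 *ℤ Φₛ (m * p) N
      ≡⟨ ⋆-single-term (φ m) N (proj₂ (Φ-deg m (s≤s z≤n)))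
                       (block-gap-below Φ m p i m<p t-tdeg d-deg φm<gap) ⟨
    (Φₛ m ⋆ Φₛ (m * p)) N
      ≡⟨ sparse-Φ⋆Φ p-prime m (s≤s z≤n) m<p N p∤N ⟩
    0ℤ ∎)
  where
  open Cyclotomic Φ isCyc
  open ≡-Reasoning
  N : ℕ
  N = i * p + (m + t)
  Φₘₚ[N]≢0 : Φₛ (m * p) N ≢ 0ℤ
  Φₘₚ[N]≢0 = proj₂ (tdeg-block₁ Φ m p i t-tdeg)
  p∤N : ¬ (p ∣ N)
  p∤N p∣N = ℕ.<⇒≱ (proj₁ (tdeg-block₁ Φ m p i t-tdeg)) (∣⇒≤ (∣m+n∣m⇒∣n p∣N (n∣m*n i)))
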